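{- Let $n\ge 2$ and let $G$ be a graph on $2n+1$ vertices with at least $n^2+n$ edges such that $G$ contains no two distinct vertices of equal degree joined by a path of length three. Let $\beta$ be the largest integer such that $G$ contains two vertices of degree $\beta$, and let $u,v$ be two distinct vertices with $d(u)=d(v)=\beta$. Let $\mathbf{1}_{uv}=1$ if $uv\in E(G)$ and $\mathbf{1}_{uv}=0$ otherwise, and set $c:=\beta-n-\mathbf{1}_{uv}$. If $c\ge 1$, then the complement $\overline{G}$ satisfies \[ e(\overline{G})\ge n^2+c^2-c-\mathbf{1}_{uv}. \]
   Context: Graphs are finite and simple; $e(H)$ denotes the number of edges of $H$ and $\overline{G}$ is the complement graph of $G$. A path of length three joining $a$ and $b$ is a path $a\,x\,y\,b$ on four distinct vertices with three edges. -}

module Defs where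

import Data.Nat
open import Data.Nat using (ℕ; zero; suc; _+_; _<ᵇ_)
open import Data.Bool using (Bool; true; false; _∧_; not)
open import Data.Fin using (Fin; zero; suc; toℕ; _≟_)
open import Data.Empty using (⊥)
open import Data.Product using (Σ; _×_; ∃; ∃-syntax)
open import Relation.Binary.PropositionalEquality using (_≡_; _≢_)
open import Relation.Nullary.Decidable using (⌊_⌋)

record Graph (m : ℕ) : Set where
  field
    adj    : Fin m → Fin m → Bool
    sym    : ∀ i j → adj i j ≡ adj j i
    irrefl : ∀ i → adj i i ≡ false
open Graph public

b2n : Bool → ℕ
b2n true  = 1
b2n false = 0

sumFin : ∀ m → (Fin m → ℕ) → ℕ
sumFin zero    f = 0
sumFin (suc m) f = f zero + sumFin m (λ i → f (suc i))

deg : ∀ {m} → Graph m → Fin m → ℕ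
deg {m} G i = sumFin m (λ j → b2n (adj G i j))

edgeCount : ∀ {m} → (Fin m → Fin m → Bool) → ℕ
edgeCount {m} a = sumFin m (λ i → sumFin m (λ j → b2n ((toℕ i <ᵇ toℕ j) ∧ a i j)))

e : ∀ {m} → Graph m → ℕ
e G = edgeCount (adj G)

complAdj : ∀ {m} → Graph m → Fin m → Fin m → Bool
complAdj G i j = not (adj G i j) ∧ not ⌊ i ≟ j ⌋

eCompl : ∀ {m} → Graph m → ℕ
eCompl G = edgeCount (complAdj G)

Edge : ∀ {m} → Graph m → Fin m → Fin m → Set
Edge G i j = adj G i j ≡ true

Path3 : ∀ {m} → Graph m → Fin m → Fin m → Set
Path3 G a b = ∃[ x ] ∃[ y ]
  ( (a ≢ x) × (a ≢ y) × (a ≢ b) × (x ≢ y) × (x ≢ b) × (y ≢ b)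
  × Edge G a x × Edge G x y × Edge G y b )

NoEqDegP3 : ∀ {m} → Graph m → Set
NoEqDegP3 G = ∀ a b → a ≢ b → deg G a ≡ deg G b → Path3 G a b → ⊥

IsMaxRepeatedDeg : ∀ {m} → Graph m → ℕ → Set
IsMaxRepeatedDeg G β =
  (∃[ a ] ∃[ b ] (a ≢ b × deg G a ≡ β × deg G b ≡ β))
  × (∀ a b → a ≢ b → deg G a ≡ deg G b → deg G a Data.Nat.≤ β)

-- Let A and B be the vertices adjacent to u only and to v only, I the common neighbours and W
-- the vertices other than u, v adjacent to neither.  For x ∈ A ∪ I and y ∈ B ∪ I the path
-- u x y v is forbidden, so A ∪ I and B ∪ I span no edge; hence every x ∈ I has degree
-- 2 + d_W(x), and the degree conditions force |A| = |B| and |I| = |W| + 2c + 1.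
-- If uv is an edge, two vertices x, y ∈ I have equal degree by pigeonhole, and x u v y is a
-- forbidden path.  Otherwise sum the degrees of the complement class by class.  The only term
-- not fixed by the class sizes is 2e(W) − 2·#(non-adjacent pairs in I × W), and it is ≤ 0:
-- scanning the values of d_W downwards, either the vertices of I above a level v have
-- distinct d_W, so (as |I| ≥ |W|) at least v vertices of I lie at or below it, or two of them
-- share a value t > v; then their W-neighbourhoods span no edge, whence 2e(W) ≤ w(w−1) − t(t−1).
module Submission where

open import Defs hiding (sym)
open import Data.Nat
open import Data.Nat.Properties
open import Data.Nat.Tactic.RingSolver using (solve-∀)
open import Data.Bool using (Bool; true; false; _∧_; not; if_then_else_; T)
open import Data.Bool.Properties using (∧-conicalˡ; ∧-conicalʳ)
open import Data.Fin as Fin using (Fin; zero; suc; toℕ)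
import Data.Fin.Properties as Finₚ
open import Data.Product using (_×_; _,_; ∃; ∃₂; proj₁; proj₂)
open import Data.Empty using (⊥; ⊥-elim)
open import Data.Sum using (_⊎_; inj₁; inj₂)
open import Function using (_∘_; id)
open import Relation.Binary.PropositionalEquality
open import Relation.Nullary using (Dec; yes; no; ¬_; contradiction)
open import Relation.Nullary.Decidable using (⌊_⌋; ⌊⌋-map′; toWitness; toWitnessFalse)

-- Finite sums and counting

sumFin-cong : ∀ m {f g : Fin m → ℕ} → (∀ i → f i ≡ g i) → sumFin m f ≡ sumFin m g
sumFin-cong zero    f≗g = refl
sumFin-cong (suc m) f≗g = cong₂ _+_ (f≗g zero) (sumFin-cong m (f≗g ∘ suc))

sumFin-mono : ∀ m {f g : Fin m → ℕ} → (∀ i → f i ≤ g i) → sumFin m f ≤ sumFin m g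
sumFin-mono zero    f≤g = z≤n
sumFin-mono (suc m) f≤g = +-mono-≤ (f≤g zero) (sumFin-mono m (f≤g ∘ suc))

sumFin-distrib-+ : ∀ m (f g : Fin m → ℕ) → sumFin m (λ i → f i + g i) ≡ sumFin m f + sumFin m g
sumFin-distrib-+ zero    f g = refl
sumFin-distrib-+ (suc m) f g = begin
  f zero + g zero + sumFin m (λ i → f (suc i) + g (suc i))
    ≡⟨ cong (f zero + g zero +_) (sumFin-distrib-+ m (f ∘ suc) (g ∘ suc)) ⟩
  f zero + g zero + (sumFin m (f ∘ suc) + sumFin m (g ∘ suc))
    ≡⟨ +-exchange (f zero) (g zero) _ _ ⟩
  f zero + sumFin m (f ∘ suc) + (g zero + sumFin m (g ∘ suc)) ∎
  where
  open ≡-Reasoning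
  +-exchange : ∀ a b c d → a + b + (c + d) ≡ a + c + (b + d)
  +-exchange = solve-∀

sumFin-distribʳ-* : ∀ m (f : Fin m → ℕ) c → sumFin m (λ i → f i * c) ≡ sumFin m f * c
sumFin-distribʳ-* zero    f c = refl
sumFin-distribʳ-* (suc m) f c = trans (cong (f zero * c +_) (sumFin-distribʳ-* m (f ∘ suc) c))
                                      (sym (*-distribʳ-+ c (f zero) _))

sumFin-const : ∀ m c → sumFin m (λ _ → c) ≡ m * c
sumFin-const zero    c = refl
sumFin-const (suc m) c = cong (c +_) (sumFin-const m c)

sumFin-zero : ∀ m → sumFin m (λ _ → 0) ≡ 0
sumFin-zero m = trans (sumFin-const m 0) (*-zeroʳ m)

sumFin-comm : ∀ m p (f : Fin m → Fin p → ℕ) →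
              sumFin m (λ i → sumFin p (f i)) ≡ sumFin p (λ j → sumFin m (λ i → f i j))
sumFin-comm zero    p f = sym (sumFin-zero p)
sumFin-comm (suc m) p f = trans (cong (sumFin p (f zero) +_) (sumFin-comm m p (f ∘ suc)))
                                (sym (sumFin-distrib-+ p (f zero) _))

yes-witness : ∀ {a} {A : Set a} (a? : Dec A) → ⌊ a? ⌋ ≡ true → A
yes-witness a? h = toWitness {a? = a?} (subst T (sym h) _)

no-witness : ∀ {a} {A : Set a} (a? : Dec A) → not ⌊ a? ⌋ ≡ true → ¬ A
no-witness a? h = toWitnessFalse {a? = a?} (subst T (sym h) _)

b2n-∧ˡ : ∀ a b → b2n (a ∧ b) ≤ b2n a
b2n-∧ˡ true  true  = ≤-refl
b2n-∧ˡ true  false = z≤n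
b2n-∧ˡ false _     = z≤n

count : ∀ {m} → (Fin m → Bool) → ℕ
count {m} P = sumFin m (λ i → b2n (P i))

sumOver : ∀ {m} → (Fin m → Bool) → (Fin m → ℕ) → ℕ
sumOver {m} P f = sumFin m (λ i → if P i then f i else 0)

module _ {m : ℕ} where

  sumOver-cong : ∀ P {f g : Fin m → ℕ} → (∀ i → P i ≡ true → f i ≡ g i) →
                 sumOver P f ≡ sumOver P g
  sumOver-cong P f≗g = sumFin-cong m pointwise
    where
    pointwise : ∀ i → (if P i then _ else 0) ≡ (if P i then _ else 0)
    pointwise i with P i in Pi
    ... | true  = f≗g i Pi
    ... | false = refl

  sumOver-mono : ∀ P {f g : Fin m → ℕ} → (∀ i → P i ≡ true → f i ≤ g i) →
                 sumOver P f ≤ sumOver P g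
  sumOver-mono P f≤g = sumFin-mono m pointwise
    where
    pointwise : ∀ i → (if P i then _ else 0) ≤ (if P i then _ else 0)
    pointwise i with P i in Pi
    ... | true  = f≤g i Pi
    ... | false = z≤n

  sumOver-distrib-+ : ∀ P (f g : Fin m → ℕ) →
                      sumOver P (λ i → f i + g i) ≡ sumOver P f + sumOver P g
  sumOver-distrib-+ P f g = trans (sumFin-cong m pointwise) (sumFin-distrib-+ m _ _)
    where
    pointwise : ∀ i → (if P i then f i + g i else 0)
                    ≡ (if P i then f i else 0) + (if P i then g i else 0)
    pointwise i with P i
    ... | true  = refl
    ... | false = refl

  sumOver-const : ∀ P c → sumOver P (λ _ → c) ≡ count P * c
  sumOver-const P c = trans (sumFin-cong m pointwise) (sumFin-distribʳ-* m _ c)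
    where
    pointwise : ∀ i → (if P i then c else 0) ≡ b2n (P i) * c
    pointwise i with P i
    ... | true  = sym (+-identityʳ c)
    ... | false = refl

  sumOver-if : ∀ (P Q : Fin m → Bool) c →
               sumOver P (λ i → if Q i then c else 0) ≡ count (λ i → P i ∧ Q i) * c
  sumOver-if P Q c = trans (sumFin-cong m pointwise) (sumFin-distribʳ-* m _ c)
    where
    pointwise : ∀ i → (if P i then (if Q i then c else 0) else 0) ≡ b2n (P i ∧ Q i) * c
    pointwise i with P i | Q i
    ... | true  | true  = sym (+-identityʳ c)
    ... | true  | false = refl
    ... | false | _     = refl

  sumOver-b2n : ∀ (P Q : Fin m → Bool) → sumOver P (λ i → b2n (Q i)) ≡ count (λ i → P i ∧ Q i)
  sumOver-b2n P Q = sumFin-cong m pointwise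
    where
    pointwise : ∀ i → (if P i then b2n (Q i) else 0) ≡ b2n (P i ∧ Q i)
    pointwise i with P i
    ... | true  = refl
    ... | false = refl

  sumOver-count : ∀ (P : Fin m → Bool) (Q : Fin m → Fin m → Bool) →
                  sumOver P (λ i → count (Q i)) ≡ sumFin m (λ i → count (λ j → P i ∧ Q i j))
  sumOver-count P Q = sumFin-cong m pointwise
    where
    pointwise : ∀ i → (if P i then count (Q i) else 0) ≡ count (λ j → P i ∧ Q i j)
    pointwise i with P i
    ... | true  = refl
    ... | false = sym (sumFin-zero m)

  count-split : ∀ (P Q : Fin m → Bool) →
                count P ≡ count (λ i → P i ∧ Q i) + count (λ i → P i ∧ not (Q i))
  count-split P Q = trans (sumFin-cong m pointwise) (sumFin-distrib-+ m _ _)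
    where
    pointwise : ∀ i → b2n (P i) ≡ b2n (P i ∧ Q i) + b2n (P i ∧ not (Q i))
    pointwise i with P i | Q i
    ... | false | _     = refl
    ... | true  | true  = refl
    ... | true  | false = refl

  count-none : ∀ (P : Fin m → Bool) → (∀ i → P i ≢ true) → count P ≡ 0
  count-none P ¬P = trans (sumFin-cong m pointwise) (sumFin-zero m)
    where
    pointwise : ∀ i → b2n (P i) ≡ 0
    pointwise i with P i in Pi
    ... | true  = ⊥-elim (¬P i Pi)
    ... | false = refl

sumOver-≟ : ∀ {m} (z : Fin m) (f : Fin m → ℕ) → sumOver (λ i → ⌊ z Fin.≟ i ⌋) f ≡ f z
sumOver-≟ {suc m} zero    f = trans (cong (f zero +_) (sumFin-zero m)) (+-identityʳ (f zero))
sumOver-≟ {suc m} (suc z) f =  -- ⌊ suc z ≟ suc i ⌋ reduces to ⌊ z ≟ i ⌋ only propositionally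
  trans (sumFin-cong m λ i → cong (if_then f (suc i) else 0) (⌊⌋-map′ _ _ (z Fin.≟ i)))
        (sumOver-≟ z (f ∘ suc))

count-≟ : ∀ {m} (z : Fin m) → count (λ i → ⌊ z Fin.≟ i ⌋) ≡ 1
count-≟ z = begin
  count (λ i → ⌊ z Fin.≟ i ⌋)              ≡⟨ *-identityʳ _ ⟨
  count (λ i → ⌊ z Fin.≟ i ⌋) * 1          ≡⟨ sumOver-const (λ i → ⌊ z Fin.≟ i ⌋) 1 ⟨
  sumOver (λ i → ⌊ z Fin.≟ i ⌋) (λ _ → 1)  ≡⟨ sumOver-≟ z _ ⟩
  1                                        ∎
  where open ≡-Reasoning

Collision : ∀ {m} → (Fin m → Bool) → (Fin m → ℕ) → Set
Collision P f = ∃₂ λ x y → x ≢ y × P x ≡ true × P y ≡ true × f x ≡ f y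

count≥1⇒∃ : ∀ {m} (P : Fin m → Bool) → 1 ≤ count P → ∃ λ x → P x ≡ true
count≥1⇒∃ {suc m} P h with P zero in P0
... | true  = zero , P0
... | false = let x , Px = count≥1⇒∃ (P ∘ suc) h in suc x , Px

count≥2⇒∃₂ : ∀ {m} (P : Fin m → Bool) → 2 ≤ count P →
             ∃₂ λ x y → x ≢ y × P x ≡ true × P y ≡ true
count≥2⇒∃₂ {suc m} P h with P zero in P0
... | true  = let y , Py = count≥1⇒∃ (P ∘ suc) (s≤s⁻¹ h) in zero , suc y , (λ ()) , P0 , Py
... | false = let x , y , x≢y , Px , Py = count≥2⇒∃₂ (P ∘ suc) h
              in suc x , suc y , x≢y ∘ Finₚ.suc-injective , Px , Py

pigeonhole : ∀ {m} r v (P : Fin m → Bool) (f : Fin m → ℕ) →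
             (∀ i → P i ≡ true → v ≤ f i × f i < v + r) →
             count P ≤ r ⊎ Collision P f
pigeonhole zero v P f range = inj₁ (≤-reflexive (count-none P empty))
  where
  empty : ∀ i → P i ≢ true
  empty i Pi = <⇒≱ (proj₂ (range i Pi)) (subst (_≤ f i) (sym (+-identityʳ v)) (proj₁ (range i Pi)))
pigeonhole (suc r) v P f range with count (λ i → P i ∧ ⌊ f i ≟ v ⌋) ≤? 1
... | no ≰1 = let x , y , x≢y , Px , Py = count≥2⇒∃₂ _ (≰⇒> ≰1) in
  inj₂ (x , y , x≢y , ∧-conicalˡ _ _ Px , ∧-conicalˡ _ _ Py , trans (at-v x Px) (sym (at-v y Py)))
  where
  at-v : ∀ i → (P i ∧ ⌊ f i ≟ v ⌋) ≡ true → f i ≡ v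
  at-v i h = yes-witness (f i ≟ v) (∧-conicalʳ (P i) _ h)
... | yes ≤1 with pigeonhole r (suc v) (λ i → P i ∧ not ⌊ f i ≟ v ⌋) f above
  where
  above : ∀ i → (P i ∧ not ⌊ f i ≟ v ⌋) ≡ true → suc v ≤ f i × f i < suc v + r
  above i h = ≤∧≢⇒< (proj₁ (range i Pi)) (no-witness (f i ≟ v) (∧-conicalʳ (P i) _ h) ∘ sym)
            , subst (f i <_) (+-suc v r) (proj₂ (range i Pi))
    where
    Pi : P i ≡ true
    Pi = ∧-conicalˡ _ _ h
... | inj₁ ≤r = inj₁ (≤-trans (≤-reflexive (count-split P _)) (+-mono-≤ ≤1 ≤r))
... | inj₂ (x , y , x≢y , Px , Py , fx≡fy) =
  inj₂ (x , y , x≢y , ∧-conicalˡ _ _ Px , ∧-conicalˡ _ _ Py , fx≡fy)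

-- Graphs and their complements

⌊≟⌋-true : ∀ {m} {i j : Fin m} → i ≡ j → ⌊ i Fin.≟ j ⌋ ≡ true
⌊≟⌋-true i≡j = cong ⌊_⌋ (≡-≟-identity Fin._≟_ i≡j)

⌊≟⌋-false : ∀ {m} {i j : Fin m} → i ≢ j → ⌊ i Fin.≟ j ⌋ ≡ false
⌊≟⌋-false i≢j = cong ⌊_⌋ (≢-≟-identity Fin._≟_ i≢j)

⌊≟⌋-sym : ∀ {m} (i j : Fin m) → ⌊ i Fin.≟ j ⌋ ≡ ⌊ j Fin.≟ i ⌋
⌊≟⌋-sym i j with i Fin.≟ j
... | yes i≡j = sym (⌊≟⌋-true (sym i≡j))
... | no  i≢j = sym (⌊≟⌋-false (i≢j ∘ sym))

complement : ∀ {m} → Graph m → Graph m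
complement G = record
  { adj    = complAdj G
  ; sym    = λ i j → cong₂ (λ a d → not a ∧ not d) (Graph.sym G i j) (⌊≟⌋-sym i j)
  ; irrefl = λ i → cong₂ (λ a d → not a ∧ not d) (irrefl G i) (⌊≟⌋-true refl)
  }

<ᵇ-false⇒≮ : ∀ {x y} → (x <ᵇ y) ≡ false → ¬ (x < y)
<ᵇ-false⇒≮ eq x<y = subst T eq (<⇒<ᵇ x<y)

handshake : ∀ {m} (G : Graph m) → sumFin m (deg G) ≡ 2 * e G
handshake {m} G = begin
  sumFin m (λ i → sumFin m (λ j → b2n (adj G i j)))
    ≡⟨ sumFin-cong m (λ i → trans (sumFin-cong m (split i)) (sumFin-distrib-+ m _ _)) ⟩
  sumFin m (λ i → sumFin m (below i) + sumFin m (λ j → below j i))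
    ≡⟨ sumFin-distrib-+ m _ _ ⟩
  e G + sumFin m (λ i → sumFin m (λ j → below j i))
    ≡⟨ cong (e G +_) (sumFin-comm m m (λ i j → below j i)) ⟩
  e G + e G
    ≡⟨ cong (e G +_) (sym (+-identityʳ (e G))) ⟩
  2 * e G ∎
  where
  open ≡-Reasoning
  below : Fin m → Fin m → ℕ
  below i j = b2n ((toℕ i <ᵇ toℕ j) ∧ adj G i j)
  neither⇒≡ : ∀ {i j : Fin m} → (toℕ i <ᵇ toℕ j) ≡ false → (toℕ j <ᵇ toℕ i) ≡ false → i ≡ j
  neither⇒≡ i≮j j≮i = Finₚ.toℕ-injective (≤-antisym (≮⇒≥ (<ᵇ-false⇒≮ j≮i)) (≮⇒≥ (<ᵇ-false⇒≮ i≮j)))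
  split : ∀ i j → b2n (adj G i j) ≡ below i j + below j i
  split i j with toℕ i <ᵇ toℕ j in i<j | toℕ j <ᵇ toℕ i in j<i
  ... | true  | true  = contradiction (<ᵇ⇒< (toℕ j) (toℕ i) (subst T (sym j<i) _))
                                      (<⇒≯ (<ᵇ⇒< (toℕ i) (toℕ j) (subst T (sym i<j) _)))
  ... | true  | false = sym (+-identityʳ _)
  ... | false | true  = cong b2n (Graph.sym G i j)
  ... | false | false with refl ← neither⇒≡ {i} {j} i<j j<i = cong b2n (irrefl G i)

complAdj+adj+≟ : ∀ {m} (G : Graph m) z q →
                 b2n (complAdj G z q) + (b2n (adj G z q) + b2n ⌊ z Fin.≟ q ⌋) ≡ 1
complAdj+adj+≟ G z q with z Fin.≟ q | adj G z q in zq
... | yes refl | true  = contradiction (trans (sym zq) (irrefl G z)) λ ()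
... | yes refl | false = refl
... | no _     | true  = refl
... | no _     | false = refl

complement-deg : ∀ {m} (G : Graph m) z → deg (complement G) z + (deg G z + 1) ≡ m
complement-deg {m} G z = begin
  deg (complement G) z + (deg G z + 1)
    ≡⟨ cong (λ k → deg (complement G) z + (deg G z + k)) (count-≟ z) ⟨
  deg (complement G) z + (deg G z + count (λ q → ⌊ z Fin.≟ q ⌋))
    ≡⟨ trans (sumFin-distrib-+ m _ _) (cong (deg (complement G) z +_) (sumFin-distrib-+ m _ _)) ⟨
  sumFin m (λ q → b2n (complAdj G z q) + (b2n (adj G z q) + b2n ⌊ z Fin.≟ q ⌋))
    ≡⟨ sumFin-cong m (complAdj+adj+≟ G z) ⟩
  sumFin m (λ _ → 1)
    ≡⟨ trans (sumFin-const m 1) (*-identityʳ m) ⟩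
  m ∎
  where open ≡-Reasoning

module _ {m} (G : Graph m) where

  edge⇒≢ : ∀ {i j} → Edge G i j → i ≢ j
  edge⇒≢ {i} ij refl = contradiction (trans (sym ij) (irrefl G i)) λ ()

  nonadj⇒≢ : ∀ {a b c} → adj G a b ≡ false → Edge G a c → b ≢ c
  nonadj⇒≢ ab ac refl = contradiction (trans (sym ac) ab) λ ()

  no-path3 : NoEqDegP3 G → ∀ {a b x y} → a ≢ b → deg G a ≡ deg G b →
             Edge G a x → Edge G x y → Edge G y b → a ≢ y → x ≢ b → ⊥
  no-path3 noP3 a≢b deg≡ ax xy yb a≢y x≢b =
    noP3 _ _ a≢b deg≡
      (_ , _ , edge⇒≢ ax , a≢y , a≢b , edge⇒≢ xy , x≢b , edge⇒≢ yb , ax , xy , yb)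

-- Edges inside W against non-edges between I and W

module DegreesInto {m} (G : Graph m) (W : Fin m → Bool) where

  degW : Fin m → ℕ
  degW z = count (λ q → W q ∧ adj G z q)

  w : ℕ
  w = count W

  sumW : ℕ
  sumW = sumOver W degW

  NoPathThroughW : Fin m → Fin m → Set
  NoPathThroughW x y = ∀ {p q} → W p ≡ true → W q ≡ true →
                       Edge G x p → Edge G p q → Edge G q y → ⊥

  degW≤w : ∀ z → degW z ≤ w
  degW≤w z = sumFin-mono m (λ q → b2n-∧ˡ (W q) _)

  degW<w : ∀ {p} → W p ≡ true → degW p + 1 ≤ w
  degW<w {p} Wp = subst (_≤ w) (trans (sumFin-distrib-+ m _ _) (cong (degW p +_) (count-≟ p)))
                               (sumFin-mono m pointwise)
    where
    pointwise : ∀ q → b2n (W q ∧ adj G p q) + b2n ⌊ p Fin.≟ q ⌋ ≤ b2n (W q)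
    pointwise q with p Fin.≟ q
    ... | yes refl rewrite Wp | irrefl G p = ≤-refl
    ... | no  _    = ≤-trans (≤-reflexive (+-identityʳ _)) (b2n-∧ˡ (W q) _)

  degW-nbr+degW≤w : ∀ {x y p} → NoPathThroughW x y → W p ≡ true → Edge G x p →
                    degW p + degW y ≤ w
  degW-nbr+degW≤w {x} {y} {p} free Wp xp =
    subst (_≤ w) (sumFin-distrib-+ m _ _) (sumFin-mono m pointwise)
    where
    pointwise : ∀ q → b2n (W q ∧ adj G p q) + b2n (W q ∧ adj G y q) ≤ b2n (W q)
    pointwise q with W q in Wq | adj G p q in pq | adj G y q in yq
    ... | false | _     | _     = z≤n
    ... | true  | false | _     = b2n-∧ˡ true _
    ... | true  | true  | false = ≤-refl
    ... | true  | true  | true  = ⊥-elim (free Wp Wq xp pq (trans (Graph.sym G q y) yq))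

  private
    n*n≡n*pred[n]+n : ∀ n → n * n ≡ n * pred n + n
    n*n≡n*pred[n]+n zero    = refl
    n*n≡n*pred[n]+n (suc n) = trans (*-suc (suc n) n) (+-comm (suc n) _)

    sumW-bound : ∀ (extra : Fin m → ℕ) → (∀ p → W p ≡ true → degW p + 1 + extra p ≤ w) →
                 sumW + sumOver W extra ≤ w * pred w
    sumW-bound extra bound = +-cancelʳ-≤ w _ _ (begin
      sumW + sumOver W extra + w
        ≡⟨ rearrange sumW (sumOver W extra) w ⟩
      sumW + w * 1 + sumOver W extra
        ≡⟨ cong (_+ sumOver W extra) (trans (sumOver-distrib-+ W degW (λ _ → 1))
                                            (cong (sumW +_) (sumOver-const W 1))) ⟨
      sumOver W (λ p → degW p + 1) + sumOver W extra
        ≡⟨ sumOver-distrib-+ W (λ p → degW p + 1) extra ⟨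
      sumOver W (λ p → degW p + 1 + extra p)
        ≤⟨ sumOver-mono W bound ⟩
      sumOver W (λ _ → w)
        ≡⟨ trans (sumOver-const W w) (n*n≡n*pred[n]+n w) ⟩
      w * pred w + w ∎)
      where
      open ≤-Reasoning
      rearrange : ∀ a b c → a + b + c ≡ a + c * 1 + b
      rearrange = solve-∀

  sumW≤w*pred[w] : sumW ≤ w * pred w
  sumW≤w*pred[w] = ≤-trans (m≤m+n sumW _)
    (sumW-bound (λ _ → 0) (λ p Wp → ≤-trans (≤-reflexive (+-identityʳ _)) (degW<w Wp)))

  -- A vertex p ∈ W has at most w − 1 neighbours in W, and at most w − t if p is adjacent to x,
  -- since then its W-neighbours avoid the t W-neighbours of y.
  sumW+tie≤w*pred[w] : ∀ {x y} → NoPathThroughW x y → degW x ≡ degW y →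
                       sumW + degW y * pred (degW y) ≤ w * pred w
  sumW+tie≤w*pred[w] {x} {y} free x≡y =
    subst (λ s → sumW + s ≤ w * pred w) extra-sum (sumW-bound extra bound)
    where
    extra : Fin m → ℕ
    extra p = if adj G x p then pred (degW y) else 0
    extra-sum : sumOver W extra ≡ degW y * pred (degW y)
    extra-sum = trans (sumOver-if W (adj G x) _) (cong (_* pred (degW y)) x≡y)
    bound : ∀ p → W p ≡ true → degW p + 1 + extra p ≤ w
    bound p Wp with adj G x p in xp | degW y in t≡
    ... | false | _     = ≤-trans (≤-reflexive (+-identityʳ _)) (degW<w Wp)
    ... | true  | zero  = ≤-trans (≤-reflexive (+-identityʳ _)) (degW<w Wp)
    ... | true  | suc t = subst (_≤ w) (trans (cong (degW p +_) t≡) (sym (+-assoc (degW p) 1 t)))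
                                (degW-nbr+degW≤w free Wp xp)

  module _ (I : Fin m → Bool) where

    k : ℕ
    k = count I

    sumI : ℕ
    sumI = sumOver I degW

    nonNbrsI : Fin m → ℕ
    nonNbrsI p = count (λ x → I x ∧ not (adj G p x))

    nonNbrsI+sumI≡kw : sumOver W nonNbrsI + sumI ≡ k * w
    nonNbrsI+sumI≡kw = begin
      sumOver W nonNbrsI + sumI
        ≡⟨ cong₂ _+_ (trans (sumOver-count W _) (sumFin-comm m m _)) (sumOver-count I _) ⟩
      sumFin m (λ x → count (λ p → W p ∧ (I x ∧ not (adj G p x))))
        + sumFin m (λ x → count (λ p → I x ∧ (W p ∧ adj G x p)))
        ≡⟨ sumFin-distrib-+ m _ _ ⟨
      sumFin m (λ x → count (λ p → W p ∧ (I x ∧ not (adj G p x)))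
                    + count (λ p → I x ∧ (W p ∧ adj G x p)))
        ≡⟨ sumFin-cong m (λ x → trans (sumFin-cong m (edge-or-not x)) (sumFin-distrib-+ m _ _)) ⟨
      sumFin m (λ x → count (λ p → I x ∧ W p))
        ≡⟨ trans (sym (sumOver-const I w)) (sumOver-count I (λ _ → W)) ⟨
      k * w ∎
      where
      open ≡-Reasoning
      edge-or-not : ∀ x p → b2n (I x ∧ W p)
                          ≡ b2n (W p ∧ (I x ∧ not (adj G p x))) + b2n (I x ∧ (W p ∧ adj G x p))
      edge-or-not x p rewrite Graph.sym G p x with I x | W p | adj G x p
      ... | false | false | _     = refl
      ... | false | true  | _     = refl
      ... | true  | false | _     = refl
      ... | true  | true  | false = refl
      ... | true  | true  | true  = refl

    degW-collision : w + 2 ≤ k → Collision I degW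
    degW-collision w+2≤k with pigeonhole (suc w) 0 I degW (λ z _ → z≤n , s≤s (degW≤w z))
    ... | inj₂ collision = collision
    ... | inj₁ k≤1+w     =
      contradiction (subst (_≤ suc w) (+-comm w 2) (≤-trans w+2≤k k≤1+w)) 1+n≰n

    -- deficit 0 is the number of non-adjacent pairs in I × W.
    deficit : ℕ → ℕ
    deficit v = sumOver I (λ z → w ∸ (v ⊔ degW z))

    countLe : ℕ → ℕ
    countLe v = count (λ z → I z ∧ ⌊ degW z ≤? v ⌋)

    sumI+deficit0≡kw : sumI + deficit 0 ≡ k * w
    sumI+deficit0≡kw = begin
      sumI + deficit 0                         ≡⟨ sumOver-distrib-+ I degW _ ⟨
      sumOver I (λ z → degW z + (w ∸ degW z))  ≡⟨ sumOver-cong I (λ z _ → m+[n∸m]≡n (degW≤w z)) ⟩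
      sumOver I (λ _ → w)                      ≡⟨ sumOver-const I w ⟩
      k * w                                    ∎
      where open ≡-Reasoning

    deficit-step : ∀ {v} → v < w → deficit v ≡ deficit (suc v) + countLe v
    deficit-step {v} v<w = begin
      deficit v
        ≡⟨ sumOver-cong I (λ z _ → layer (degW z)) ⟩
      sumOver I (λ z → w ∸ (suc v ⊔ degW z) + b2n ⌊ degW z ≤? v ⌋)
        ≡⟨ sumOver-distrib-+ I _ _ ⟩
      deficit (suc v) + sumOver I (λ z → b2n ⌊ degW z ≤? v ⌋)
        ≡⟨ cong (deficit (suc v) +_) (sumOver-b2n I _) ⟩
      deficit (suc v) + countLe v ∎
      where
      open ≡-Reasoning
      layer : ∀ d → w ∸ (v ⊔ d) ≡ w ∸ (suc v ⊔ d) + b2n ⌊ d ≤? v ⌋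
      layer d with d ≤? v
      ... | yes d≤v rewrite m≥n⇒m⊔n≡m d≤v | m≥n⇒m⊔n≡m (m≤n⇒m≤1+n d≤v) =
            trans (+-∸-assoc 1 v<w) (+-comm 1 _)
      ... | no  d≰v rewrite m≤n⇒m⊔n≡n (<⇒≤ (≰⇒> d≰v)) | m≤n⇒m⊔n≡n (≰⇒> d≰v) =
            sym (+-identityʳ _)

    deficit-suc≤ : ∀ {v} → v < w → deficit (suc v) ≤ deficit v
    deficit-suc≤ v<w = ≤-trans (m≤m+n _ _) (≤-reflexive (sym (deficit-step v<w)))

    module _ (w≤k : w ≤ k)
             (ties-free : ∀ {x y} → x ≢ y → I x ≡ true → I y ≡ true → degW x ≡ degW y →
                          NoPathThroughW x y) where

      private
        v<w : ∀ {v r} → v + suc r ≡ w → v < w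
        v<w {v} v+1+r≡w = subst (v <_) v+1+r≡w (m<m+n v z<s)

        suc[n]*n≡2n+n*pred[n] : ∀ n → suc n * n ≡ 2 * n + n * pred n
        suc[n]*n≡2n+n*pred[n] zero    = refl
        suc[n]*n≡2n+n*pred[n] (suc n) = lemma n
          where
          lemma : ∀ n → suc (suc n) * suc n ≡ 2 * suc n + suc n * n
          lemma = solve-∀

      tie-above : ∀ {v x y} → x ≢ y → I x ≡ true → I y ≡ true → degW x ≡ degW y →
                  suc v ≤ degW y → w * pred w ≤ 2 * deficit (suc v) + suc v * v →
                  sumW ≤ 2 * deficit (suc v)
      tie-above {v} {x} {y} x≢y Ix Iy x≡y v<t above = +-cancelʳ-≤ (t * pred t) _ _ (begin
        sumW + t * pred t                 ≤⟨ sumW+tie≤w*pred[w] (ties-free x≢y Ix Iy x≡y) x≡y ⟩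
        w * pred w                        ≤⟨ above ⟩
        2 * deficit (suc v) + suc v * v   ≤⟨ +-monoʳ-≤ _ (*-mono-≤ v<t (pred-mono-≤ v<t)) ⟩
        2 * deficit (suc v) + t * pred t  ∎)
        where
        open ≤-Reasoning
        t : ℕ
        t = degW y

      no-tie-above : ∀ {v} → v < w → v ≤ countLe v →
                     w * pred w ≤ 2 * deficit (suc v) + suc v * v →
                     w * pred w ≤ 2 * deficit v + v * pred v
      no-tie-above {v} v<w v≤c above = begin
        w * pred w
          ≤⟨ above ⟩
        2 * deficit (suc v) + suc v * v
          ≡⟨ cong (2 * deficit (suc v) +_) (suc[n]*n≡2n+n*pred[n] v) ⟩
        2 * deficit (suc v) + (2 * v + v * pred v)
          ≤⟨ +-monoʳ-≤ (2 * deficit (suc v)) (+-monoˡ-≤ (v * pred v) (*-monoʳ-≤ 2 v≤c)) ⟩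
        2 * deficit (suc v) + (2 * countLe v + v * pred v)
          ≡⟨ regroup (deficit (suc v)) (countLe v) (v * pred v) ⟩
        2 * (deficit (suc v) + countLe v) + v * pred v
          ≡⟨ cong (λ d → 2 * d + v * pred v) (deficit-step v<w) ⟨
        2 * deficit v + v * pred v ∎
        where
        open ≤-Reasoning
        regroup : ∀ d c x → 2 * d + (2 * c + x) ≡ 2 * (d + c) + x
        regroup = solve-∀

      above-range : ∀ {v r} → v + suc r ≡ w → ∀ z → (I z ∧ not ⌊ degW z ≤? v ⌋) ≡ true →
                    suc v ≤ degW z × degW z < suc v + suc r
      above-range {v} v+1+r≡w z h =
        ≰⇒> (no-witness (degW z ≤? v) (∧-conicalʳ (I z) _ h)) ,
        s≤s (subst (degW z ≤_) (sym v+1+r≡w) (degW≤w z))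

      -- The scan of the levels v = w, w − 1, …, 0 (r = w − v); the right disjunct records that a
      -- W-degree shared by two vertices of I has been met, which already bounds sumW.
      descend : ∀ r v → v + r ≡ w →
                w * pred w ≤ 2 * deficit v + v * pred v ⊎ sumW ≤ 2 * deficit v
      descend zero v v+0≡w =
        inj₁ (subst (λ u → u * pred u ≤ 2 * deficit v + v * pred v)
                    (trans (sym (+-identityʳ v)) v+0≡w) (m≤n+m _ _))
      descend (suc r) v v+1+r≡w with descend r (suc v) (trans (sym (+-suc v r)) v+1+r≡w)
      ... | inj₂ done = inj₂ (≤-trans done (*-monoʳ-≤ 2 (deficit-suc≤ (v<w v+1+r≡w))))
      ... | inj₁ above
        with pigeonhole (suc r) (suc v) (λ z → I z ∧ not ⌊ degW z ≤? v ⌋) degW (above-range v+1+r≡w)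
      ...   | inj₂ (x , y , x≢y , Ix , Iy , x≡y) =
        inj₂ (≤-trans (tie-above x≢y (∧-conicalˡ _ _ Ix) (∧-conicalˡ _ _ Iy) x≡y
                                 (proj₁ (above-range v+1+r≡w y Iy)) above)
                      (*-monoʳ-≤ 2 (deficit-suc≤ (v<w v+1+r≡w))))
      ...   | inj₁ few = inj₁ (no-tie-above (v<w v+1+r≡w) v≤countLe above)
        where
        v≤countLe : v ≤ countLe v
        v≤countLe = +-cancelʳ-≤ (suc r) v (countLe v) (begin
          v + suc r          ≡⟨ v+1+r≡w ⟩
          w                  ≤⟨ w≤k ⟩
          k                  ≡⟨ count-split I _ ⟩
          countLe v + _      ≤⟨ +-monoʳ-≤ (countLe v) few ⟩
          countLe v + suc r  ∎)
          where open ≤-Reasoning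

      sumW+2sumI≤2kw : sumW + 2 * sumI ≤ 2 * (k * w)
      sumW+2sumI≤2kw = begin
        sumW + 2 * sumI           ≤⟨ +-monoˡ-≤ (2 * sumI) sumW≤2deficit0 ⟩
        2 * deficit 0 + 2 * sumI  ≡⟨ *-distribˡ-+ 2 (deficit 0) sumI ⟨
        2 * (deficit 0 + sumI)    ≡⟨ cong (2 *_) (trans (+-comm (deficit 0) sumI) sumI+deficit0≡kw) ⟩
        2 * (k * w)               ∎
        where
        open ≤-Reasoning
        sumW≤2deficit0 : sumW ≤ 2 * deficit 0
        sumW≤2deficit0 with descend w 0 refl
        ... | inj₁ bound = ≤-trans sumW≤w*pred[w] (≤-trans bound (≤-reflexive (+-identityʳ _)))
        ... | inj₂ bound = bound

-- Arithmetic of the final count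

+-swapʳ : ∀ x y z → x + y + z ≡ x + z + y
+-swapʳ = solve-∀

∸∸-split : ∀ x y z → 1 ≤ x ∸ y ∸ z → x ≡ y + z + (x ∸ y ∸ z)
∸∸-split x y z pos = begin
  x                      ≡⟨ m+[n∸m]≡n {y} (<⇒≤ y<x) ⟨
  y + (x ∸ y)            ≡⟨ cong (y +_) (m+[n∸m]≡n {z} (<⇒≤ z<x∸y)) ⟨
  y + (z + (x ∸ y ∸ z))  ≡⟨ +-assoc y z _ ⟨
  y + z + (x ∸ y ∸ z)    ∎
  where
  open ≡-Reasoning
  z<x∸y : z < x ∸ y
  z<x∸y = m∸n≢0⇒n<m (n>0⇒n≢0 pos)
  y<x : y < x
  y<x = m∸n≢0⇒n<m (n>0⇒n≢0 (≤-trans pos (m∸n≤m (x ∸ y) z)))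

degree-relations : ∀ {n ε c a b k w} → a + k + ε ≡ n + ε + c → b + k + ε ≡ n + ε + c →
                   1 + (1 + (a + (b + (k + w)))) ≡ 2 * n + 1 →
                   b ≡ a × k ≡ w + (2 * c + 1) × n ≡ a + w + c + 1
degree-relations {n} {ε} {c} {a} {b} {k} {w} deg-u deg-v partition = b≡a , k≡ , n≡
  where
  a+k≡n+c : a + k ≡ n + c
  a+k≡n+c = +-cancelʳ-≡ ε _ _ (trans deg-u (+-swapʳ n ε c))
  b+k≡n+c : b + k ≡ n + c
  b+k≡n+c = +-cancelʳ-≡ ε _ _ (trans deg-v (+-swapʳ n ε c))
  b≡a : b ≡ a
  b≡a = +-cancelʳ-≡ k b a (trans b+k≡n+c (sym a+k≡n+c))
  k≡ : k ≡ w + (2 * c + 1)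
  k≡ = +-cancelˡ-≡ (2 * n + 1) _ _ (begin
    2 * n + 1 + k                      ≡⟨ cong (_+ k) partition ⟨
    1 + (1 + (a + (b + (k + w)))) + k  ≡⟨ regroup a b k w ⟩
    2 + (a + k) + (b + k) + w          ≡⟨ cong₂ (λ s t → 2 + s + t + w) a+k≡n+c b+k≡n+c ⟩
    2 + (n + c) + (n + c) + w          ≡⟨ expand n c w ⟩
    2 * n + 1 + (w + (2 * c + 1))      ∎)
    where
    open ≡-Reasoning
    regroup : ∀ a b k w → 1 + (1 + (a + (b + (k + w)))) + k ≡ 2 + (a + k) + (b + k) + w
    regroup = solve-∀
    expand : ∀ n c w → 2 + (n + c) + (n + c) + w ≡ 2 * n + 1 + (w + (2 * c + 1))
    expand = solve-∀
  n≡ : n ≡ a + w + c + 1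
  n≡ = +-cancelʳ-≡ c _ _ (trans (sym a+k≡n+c) (trans (cong (a +_) k≡) (expand a w c)))
    where
    expand : ∀ a w c → a + (w + (2 * c + 1)) ≡ a + w + c + 1 + c
    expand = solve-∀

-- Nκ is the sum of the complement degrees over the class κ (in the order U, V, A, B, I, W)
-- and NE the number of non-adjacent pairs in I × W.
add-complDeg-bounds : ∀ {N Nu Nv NA NB NI NW sumI sumW NE a b k w β m} →
  Nu + (Nv + (NA + (NB + (NI + NW)))) ≡ N →
  Nu + (β + 1) ≡ m → Nv + (β + 1) ≡ m → a * (β + 1) ≤ NA → b * (β + 1) ≤ NB →
  NI + (sumI + k * 3) ≡ k * m → w * 2 + (NE + w * w) ≤ NW + (sumW + w * 1) →
  NE + sumI ≡ k * w → sumW + 2 * sumI ≤ 2 * (k * w) →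
  m + m + a * (β + 1) + b * (β + 1) + k * m + (w * 2 + w * w)
    ≤ N + (2 * (β + 1) + k * 3 + w + k * w)
add-complDeg-bounds {N} {Nu} {Nv} {NA} {NB} {NI} {NW} {sumI} {sumW} {NE} {a} {b} {k} {w} {β} {m}
                    total hU hV hA hB hI hW hNE hkey =
  +-cancelʳ-≤ (k * w + (sumW + sumI)) _ _ (begin
    L + (w * 2 + w * w) + (k * w + (sumW + sumI))
      ≡⟨ cong (λ t → L + (w * 2 + w * w) + (t + (sumW + sumI))) hNE ⟨
    L + (w * 2 + w * w) + (NE + sumI + (sumW + sumI))
      ≡⟨ regroupˡ L w NE sumI sumW ⟩
    L + (w * 2 + (NE + w * w)) + (sumW + 2 * sumI)
      ≤⟨ +-mono-≤ (+-mono-≤ (+-mono-≤ (+-mono-≤ (+-mono-≤ (+-mono-≤ (≤-reflexive (sym hU))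
                                                                      (≤-reflexive (sym hV)))
                                                          hA) hB) (≤-reflexive (sym hI))) hW) hkey ⟩
    Nu + (β + 1) + (Nv + (β + 1)) + NA + NB + (NI + (sumI + k * 3)) + (NW + (sumW + w * 1))
      + 2 * (k * w)
      ≡⟨ regroupʳ Nu Nv NA NB NI NW sumI sumW k w β ⟩
    Nu + (Nv + (NA + (NB + (NI + NW)))) + Q + (k * w + (sumW + sumI))
      ≡⟨ cong (λ t → t + Q + (k * w + (sumW + sumI))) total ⟩
    N + Q + (k * w + (sumW + sumI)) ∎)
  where
  open ≤-Reasoning
  L Q : ℕ
  L = m + m + a * (β + 1) + b * (β + 1) + k * m
  Q = 2 * (β + 1) + k * 3 + w + k * w
  regroupˡ : ∀ L w NE sumI sumW → L + (w * 2 + w * w) + (NE + sumI + (sumW + sumI))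
                                   ≡ L + (w * 2 + (NE + w * w)) + (sumW + 2 * sumI)
  regroupˡ = solve-∀
  regroupʳ : ∀ Nu Nv NA NB NI NW sumI sumW k w β →
    Nu + (β + 1) + (Nv + (β + 1)) + NA + NB + (NI + (sumI + k * 3)) + (NW + (sumW + w * 1))
      + 2 * (k * w)
      ≡ Nu + (Nv + (NA + (NB + (NI + NW)))) + (2 * (β + 1) + k * 3 + w + k * w)
          + (k * w + (sumW + sumI))
  regroupʳ = solve-∀

substitute-parameters : ∀ {N a k w c n β m} →
  k ≡ w + (2 * c + 1) → β ≡ a + k → n ≡ a + w + c + 1 → m ≡ 2 * n + 1 →
  m + m + a * (β + 1) + a * (β + 1) + k * m + (w * 2 + w * w)
    ≤ N + (2 * (β + 1) + k * 3 + w + k * w) →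
  2 * (n * n + c * c) ≤ N + 2 * c
substitute-parameters {N} {a} {k} {w} {c} {n} {β} {m} refl refl refl refl counted =
  +-cancelʳ-≤ Q _ _ (begin
    2 * (n * n + c * c) + Q                    ≤⟨ +-monoˡ-≤ Q (m≤m+n (2 * (n * n + c * c)) _) ⟩
    2 * (n * n + c * c) + 4 * a * (c + 1) + Q  ≡⟨ expand a w c ⟩
    P + 2 * c                                  ≤⟨ +-monoˡ-≤ (2 * c) counted ⟩
    N + Q + 2 * c                              ≡⟨ +-swapʳ N Q (2 * c) ⟩
    N + 2 * c + Q                              ∎)
  where
  open ≤-Reasoning
  P Q : ℕ
  P = m + m + a * (β + 1) + a * (β + 1) + k * m + (w * 2 + w * w)
  Q = 2 * (β + 1) + k * 3 + w + k * w
  expand : ∀ a w c →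
    let k = w + (2 * c + 1); β = a + k; n = a + w + c + 1; m = 2 * n + 1 in
    2 * (n * n + c * c) + 4 * a * (c + 1) + (2 * (β + 1) + k * 3 + w + k * w)
      ≡ m + m + a * (β + 1) + a * (β + 1) + k * m + (w * 2 + w * w) + 2 * c
  expand = solve-∀

-- The classes around u and v

data Kind : Set where
  U V A B I W : Kind

index : Kind → ℕ
index U = 0
index V = 1
index A = 2
index B = 3
index I = 4
index W = 5

unindex : ℕ → Kind
unindex 0 = U
unindex 1 = V
unindex 2 = A
unindex 3 = B
unindex 4 = I
unindex _ = W

unindex-index : ∀ κ → unindex (index κ) ≡ κ
unindex-index U = refl
unindex-index V = refl
unindex-index A = refl
unindex-index B = refl
unindex-index I = refl
unindex-index W = refl

_==_ : Kind → Kind → Bool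
κ == κ′ = index κ ≡ᵇ index κ′

==⇒≡ : ∀ {κ κ′} → (κ == κ′) ≡ true → κ ≡ κ′
==⇒≡ {κ} {κ′} h = begin
  κ                   ≡⟨ unindex-index κ ⟨
  unindex (index κ)   ≡⟨ cong unindex (≡ᵇ⇒≡ (index κ) (index κ′) (subst T (sym h) _)) ⟩
  unindex (index κ′)  ≡⟨ unindex-index κ′ ⟩
  κ′                  ∎
  where open ≡-Reasoning

module Neighbourhoods {m} (G : Graph m) (u v : Fin m) (u≢v : u ≢ v) where

  kind : Fin m → Kind
  kind q with u Fin.≟ q | v Fin.≟ q | adj G u q | adj G v q
  ... | yes _ | _     | _     | _     = U
  ... | no _  | yes _ | _     | _     = V
  ... | no _  | no _  | true  | false = A
  ... | no _  | no _  | false | true  = B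
  ... | no _  | no _  | true  | true  = I
  ... | no _  | no _  | false | false = W

  Facts : Kind → Fin m → Set
  Facts U q = u ≡ q
  Facts V q = v ≡ q
  Facts A q = Edge G u q × adj G v q ≡ false × v ≢ q
  Facts B q = adj G u q ≡ false × Edge G v q × u ≢ q
  Facts I q = Edge G u q × Edge G v q
  Facts W q = adj G u q ≡ false × adj G v q ≡ false × u ≢ q × v ≢ q

  kind-facts : ∀ q → Facts (kind q) q
  kind-facts q with u Fin.≟ q | v Fin.≟ q | adj G u q in uq | adj G v q in vq
  ... | yes u≡q | _       | _     | _     = u≡q
  ... | no _    | yes v≡q | _     | _     = v≡q
  ... | no _    | no v≢q  | true  | false = uq , vq , v≢q
  ... | no u≢q  | no _    | false | true  = uq , vq , u≢q
  ... | no _    | no _    | true  | true  = uq , vq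
  ... | no u≢q  | no v≢q  | false | false = uq , vq , u≢q , v≢q

  is : Kind → Fin m → Bool
  is κ q = kind q == κ

  facts : ∀ κ {q} → is κ q ≡ true → Facts κ q
  facts κ {q} h = subst (λ κ′ → Facts κ′ q) (==⇒≡ h) (kind-facts q)

  size : Kind → ℕ
  size κ = count (is κ)

  is-U : ∀ q → is U q ≡ ⌊ u Fin.≟ q ⌋
  is-U q with kind q | kind-facts q
  ... | U | u≡q             = sym (⌊≟⌋-true u≡q)
  ... | V | refl            = sym (⌊≟⌋-false u≢v)
  ... | A | uq , _          = sym (⌊≟⌋-false (edge⇒≢ G uq))
  ... | B | _ , _ , u≢q     = sym (⌊≟⌋-false u≢q)
  ... | I | uq , _          = sym (⌊≟⌋-false (edge⇒≢ G uq))
  ... | W | _ , _ , u≢q , _ = sym (⌊≟⌋-false u≢q)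

  is-V : ∀ q → is V q ≡ ⌊ v Fin.≟ q ⌋
  is-V q with kind q | kind-facts q
  ... | U | refl            = sym (⌊≟⌋-false (u≢v ∘ sym))
  ... | V | v≡q             = sym (⌊≟⌋-true v≡q)
  ... | A | _ , _ , v≢q     = sym (⌊≟⌋-false v≢q)
  ... | B | _ , vq , _      = sym (⌊≟⌋-false (edge⇒≢ G vq))
  ... | I | _ , vq          = sym (⌊≟⌋-false (edge⇒≢ G vq))
  ... | W | _ , _ , _ , v≢q = sym (⌊≟⌋-false v≢q)

  size-U : size U ≡ 1
  size-U = trans (sumFin-cong m (cong b2n ∘ is-U)) (count-≟ u)

  size-V : size V ≡ 1
  size-V = trans (sumFin-cong m (cong b2n ∘ is-V)) (count-≟ v)

  sumKinds : (Kind → ℕ) → ℕ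
  sumKinds F = F U + (F V + (F A + (F B + (F I + F W))))

  sumKinds-cong : ∀ {F F′} → (∀ κ → F κ ≡ F′ κ) → sumKinds F ≡ sumKinds F′
  sumKinds-cong F≗F′ = cong₂ _+_ (F≗F′ U) (cong₂ _+_ (F≗F′ V) (cong₂ _+_ (F≗F′ A)
                       (cong₂ _+_ (F≗F′ B) (cong₂ _+_ (F≗F′ I) (F≗F′ W)))))

  sumFin-by-kind : ∀ f → sumFin m f ≡ sumKinds (λ κ → sumOver (is κ) f)
  sumFin-by-kind f = trans (sumFin-cong m split) (distribute (λ κ q → if is κ q then f q else 0))
    where
    split : ∀ q → f q ≡ sumKinds (λ κ → if is κ q then f q else 0)
    split q with kind q
    ... | U = sym (+-identityʳ _)
    ... | V = sym (+-identityʳ _)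
    ... | A = sym (+-identityʳ _)
    ... | B = sym (+-identityʳ _)
    ... | I = sym (+-identityʳ _)
    ... | W = refl
    distribute : ∀ (g : Kind → Fin m → ℕ) →
                 sumFin m (λ q → sumKinds (λ κ → g κ q)) ≡ sumKinds (λ κ → sumFin m (g κ))
    distribute g =
      trans (sumFin-distrib-+ m _ _) (cong (sumFin m (g U) +_)
      (trans (sumFin-distrib-+ m _ _) (cong (sumFin m (g V) +_)
      (trans (sumFin-distrib-+ m _ _) (cong (sumFin m (g A) +_)
      (trans (sumFin-distrib-+ m _ _) (cong (sumFin m (g B) +_)
      (sumFin-distrib-+ m _ _))))))))

  sumOver-kind-const : ∀ κ {f} c → (∀ {q} → Facts κ q → f q ≡ c) → sumOver (is κ) f ≡ size κ * c
  sumOver-kind-const κ c f≡c =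
    trans (sumOver-cong (is κ) (λ q h → f≡c (facts κ h))) (sumOver-const (is κ) c)

  sumFin-by-kind-const : ∀ f (c : Kind → ℕ) → (∀ κ {q} → Facts κ q → f q ≡ c κ) →
                         sumFin m f
                           ≡ c U + (c V + (size A * c A + (size B * c B + (size I * c I + size W * c W))))
  sumFin-by-kind-const f c f≡c = begin
    sumFin m f
      ≡⟨ sumFin-by-kind f ⟩
    sumKinds (λ κ → sumOver (is κ) f)
      ≡⟨ sumKinds-cong (λ κ → sumOver-kind-const κ (c κ) (f≡c κ)) ⟩
    size U * c U + (size V * c V + rest)
      ≡⟨ cong₂ (λ s t → s * c U + (t * c V + rest)) size-U size-V ⟩
    1 * c U + (1 * c V + rest)
      ≡⟨ cong₂ (λ s t → s + (t + rest)) (*-identityˡ (c U)) (*-identityˡ (c V)) ⟩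
    c U + (c V + rest) ∎
    where
    open ≡-Reasoning
    rest : ℕ
    rest = size A * c A + (size B * c B + (size I * c I + size W * c W))

  partition : 1 + (1 + (size A + (size B + (size I + size W)))) ≡ m
  partition = begin
    1 + (1 + (size A + (size B + (size I + size W))))
      ≡⟨ cong (λ s → 1 + (1 + s))
              (cong₂ _+_ (*-identityʳ (size A)) (cong₂ _+_ (*-identityʳ (size B))
                         (cong₂ _+_ (*-identityʳ (size I)) (*-identityʳ (size W))))) ⟨
    1 + (1 + (size A * 1 + (size B * 1 + (size I * 1 + size W * 1))))
      ≡⟨ sumFin-by-kind-const (λ _ → 1) (λ _ → 1) (λ _ _ → refl) ⟨
    sumFin m (λ _ → 1)
      ≡⟨ trans (sumFin-const m 1) (*-identityʳ m) ⟩
    m ∎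
    where open ≡-Reasoning

  ε : ℕ
  ε = b2n (adj G u v)

  deg-u : deg G u ≡ size A + size I + ε
  deg-u = trans (sumFin-by-kind-const _ nbr on) (tidy (size A) (size B) (size I) (size W) ε)
    where
    nbr : Kind → ℕ
    nbr U = 0
    nbr V = ε
    nbr A = 1
    nbr B = 0
    nbr I = 1
    nbr W = 0
    on : ∀ κ {q} → Facts κ q → b2n (adj G u q) ≡ nbr κ
    on U refl     = cong b2n (irrefl G u)
    on V refl     = refl
    on A (uq , _) = cong b2n uq
    on B (uq , _) = cong b2n uq
    on I (uq , _) = cong b2n uq
    on W (uq , _) = cong b2n uq
    tidy : ∀ a b k w e → 0 + (e + (a * 1 + (b * 0 + (k * 1 + w * 0)))) ≡ a + k + e
    tidy = solve-∀

  deg-v : deg G v ≡ size B + size I + ε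
  deg-v = trans (sumFin-by-kind-const _ nbr on) (tidy (size A) (size B) (size I) (size W) ε)
    where
    nbr : Kind → ℕ
    nbr U = ε
    nbr V = 0
    nbr A = 0
    nbr B = 1
    nbr I = 1
    nbr W = 0
    on : ∀ κ {q} → Facts κ q → b2n (adj G v q) ≡ nbr κ
    on U refl         = cong b2n (Graph.sym G v u)
    on V refl         = cong b2n (irrefl G v)
    on A (_ , vq , _) = cong b2n vq
    on B (_ , vq , _) = cong b2n vq
    on I (_ , vq)     = cong b2n vq
    on W (_ , vq , _) = cong b2n vq
    tidy : ∀ a b k w e → e + (0 + (a * 0 + (b * 1 + (k * 1 + w * 0)))) ≡ b + k + e
    tidy = solve-∀

  class-sizes : ∀ {n β} → m ≡ 2 * n + 1 → deg G u ≡ β → deg G v ≡ β → 1 ≤ β ∸ n ∸ ε →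
                let c = β ∸ n ∸ ε in
                size B ≡ size A × size I ≡ size W + (2 * c + 1) × n ≡ size A + size W + c + 1
  class-sizes {n} {β} m≡ du dv 1≤c =
    degree-relations (from deg-u du) (from deg-v dv) (trans partition m≡)
    where
    from : ∀ {x d} → d ≡ x + ε → d ≡ β → x + ε ≡ n + ε + (β ∸ n ∸ ε)
    from d≡ dβ = trans (sym d≡) (trans dβ (∸∸-split β n ε 1≤c))

  open DegreesInto G (is W) public

  module _ (noP3 : NoEqDegP3 G) {β} (du : deg G u ≡ β) (dv : deg G v ≡ β) where

    A-B-nonadjacent : ∀ {x y} → Edge G u x → v ≢ x → Edge G v y → u ≢ y → adj G x y ≡ false
    A-B-nonadjacent {x} {y} ux v≢x vy u≢y with adj G x y in xy
    ... | false = refl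
    ... | true  = ⊥-elim (no-path3 G noP3 u≢v (trans du (sym dv)) ux xy (trans (Graph.sym G y v) vy)
                                   u≢y (v≢x ∘ sym))

    deg-I : ∀ {x} → Facts I x → deg G x ≡ 2 + degW x
    deg-I {x} (ux , vx) = trans (sumFin-by-kind _) (sumKinds-cong per-kind)
      where
      counted : Kind → ℕ
      counted U = 1
      counted V = 1
      counted W = degW x
      counted _ = 0
      per-kind : ∀ κ → sumOver (is κ) (b2n ∘ adj G x) ≡ counted κ
      per-kind U = trans (sumOver-kind-const U 1 λ { refl → cong b2n (trans (Graph.sym G x u) ux) })
                         (cong (_* 1) size-U)
      per-kind V = trans (sumOver-kind-const V 1 λ { refl → cong b2n (trans (Graph.sym G x v) vx) })
                         (cong (_* 1) size-V)
      per-kind A = trans (sumOver-kind-const A 0 λ (uq , _ , v≢q) →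
                           cong b2n (trans (Graph.sym G x _) (A-B-nonadjacent uq v≢q vx (edge⇒≢ G ux))))
                         (*-zeroʳ (size A))
      per-kind B = trans (sumOver-kind-const B 0 λ (_ , vq , u≢q) →
                           cong b2n (A-B-nonadjacent ux (edge⇒≢ G vx) vq u≢q))
                         (*-zeroʳ (size B))
      per-kind I = trans (sumOver-kind-const I 0 λ (uq , vq) →
                           cong b2n (A-B-nonadjacent ux (edge⇒≢ G vx) vq (edge⇒≢ G uq)))
                         (*-zeroʳ (size I))
      per-kind W = sumOver-b2n (is W) (adj G x)

    deg-I-cong : ∀ {x y} → is I x ≡ true → is I y ≡ true → degW x ≡ degW y → deg G x ≡ deg G y
    deg-I-cong Ix Iy d≡ = trans (deg-I (facts I Ix)) (trans (cong (2 +_) d≡) (sym (deg-I (facts I Iy))))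

    I≢W : ∀ {x p} → is I x ≡ true → is W p ≡ true → x ≢ p
    I≢W Ix Wp = nonadj⇒≢ G (proj₁ (facts W Wp)) (proj₁ (facts I Ix)) ∘ sym

    I-ties-no-W-path : ∀ {x y} → x ≢ y → is I x ≡ true → is I y ≡ true → degW x ≡ degW y →
                       NoPathThroughW x y
    I-ties-no-W-path x≢y Ix Iy d≡ Wp Wq xp pq qy =
      no-path3 G noP3 x≢y (deg-I-cong Ix Iy d≡) xp pq qy (I≢W Ix Wq) (I≢W Iy Wp ∘ sym)

    no-edge-uv : Edge G u v → w + 2 ≤ size I → ⊥
    no-edge-uv uv w+2≤k with degW-collision (is I) w+2≤k
    ... | x , y , x≢y , Ix , Iy , d≡ with facts I Ix | facts I Iy
    ...   | ux , vx | uy , vy =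
      no-path3 G noP3 x≢y (deg-I-cong Ix Iy d≡) (trans (Graph.sym G x u) ux) uv vy
               (edge⇒≢ G vx ∘ sym) (edge⇒≢ G uy)

    complDegSum : Kind → ℕ
    complDegSum κ = sumOver (is κ) (deg (complement G))

    point-complDegSum : ∀ κ z → (∀ {q} → Facts κ q → z ≡ q) → size κ ≡ 1 → deg G z ≡ β →
                        complDegSum κ + (β + 1) ≡ m
    point-complDegSum κ z only size≡1 dz = begin
      complDegSum κ + (β + 1)  ≡⟨ cong (_+ (β + 1)) (sumOver-kind-const κ _ (cong nd ∘ sym ∘ only)) ⟩
      size κ * nd z + (β + 1)  ≡⟨ cong (λ s → s * nd z + (β + 1)) size≡1 ⟩
      1 * nd z + (β + 1)       ≡⟨ cong₂ _+_ (*-identityˡ (nd z)) (cong (_+ 1) (sym dz)) ⟩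
      nd z + (deg G z + 1)     ≡⟨ complement-deg G z ⟩
      m                        ∎
      where
      open ≡-Reasoning
      nd : Fin m → ℕ
      nd = deg (complement G)

    side-complDegSum : ∀ κ → (∀ {q} → Facts κ q → β + 1 ≤ deg (complement G) q) →
                       size κ * (β + 1) ≤ complDegSum κ
    side-complDegSum κ bound = subst (_≤ complDegSum κ) (sumOver-const (is κ) (β + 1))
                                     (sumOver-mono (is κ) (λ q h → bound (facts κ h)))

    I-complDegSum : complDegSum I + (sumI (is I) + size I * 3) ≡ size I * m
    I-complDegSum = begin
      complDegSum I + (sumI (is I) + size I * 3)
        ≡⟨ cong (complDegSum I +_) (trans (sumOver-distrib-+ (is I) degW (λ _ → 3))
                                          (cong (sumI (is I) +_) (sumOver-const (is I) 3))) ⟨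
      complDegSum I + sumOver (is I) (λ x → degW x + 3)
        ≡⟨ sumOver-distrib-+ (is I) (deg (complement G)) _ ⟨
      sumOver (is I) (λ x → deg (complement G) x + (degW x + 3))
        ≡⟨ sumOver-cong (is I) (λ x h → trans (cong (deg (complement G) x +_) (+3≡deg+1 (facts I h)))
                                              (complement-deg G x)) ⟩
      sumOver (is I) (λ _ → m)
        ≡⟨ sumOver-const (is I) m ⟩
      size I * m ∎
      where
      open ≡-Reasoning
      +3≡deg+1 : ∀ {x} → Facts I x → degW x + 3 ≡ deg G x + 1
      +3≡deg+1 {x} Ix = trans (+-comm (degW x) 3)
                        (trans (cong (2 +_) (+-comm 1 (degW x))) (cong (_+ 1) (sym (deg-I Ix))))

    W-complDeg : ∀ {z} → Facts W z → 2 + (nonNbrsI (is I) z + w) ≤ deg (complement G) z + (degW z + 1)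
    W-complDeg {z} (uz , vz , u≢z , v≢z) = subst₂ _≤_ lhs rhs (sumFin-mono m pointwise)
      where
      pointwise : ∀ q → b2n (is U q) + (b2n (is V q) + (b2n (is I q ∧ not (adj G z q)) + b2n (is W q)))
                      ≤ b2n (complAdj G z q) + (b2n (is W q ∧ adj G z q) + b2n ⌊ z Fin.≟ q ⌋)
      pointwise q with kind q | kind-facts q
      ... | U | refl rewrite Graph.sym G z u | uz | ⌊≟⌋-false (u≢z ∘ sym) = ≤-refl
      ... | V | refl rewrite Graph.sym G z v | vz | ⌊≟⌋-false (v≢z ∘ sym) = ≤-refl
      ... | A | _ = z≤n
      ... | B | _ = z≤n
      ... | I | uq , _ rewrite ⌊≟⌋-false (nonadj⇒≢ G uz uq) with adj G z q
      ...   | true  = z≤n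
      ...   | false = ≤-refl
      pointwise q | W | _ = ≤-reflexive (sym (complAdj+adj+≟ G z q))
      lhs : sumFin m (λ q → b2n (is U q) + (b2n (is V q) + (b2n (is I q ∧ not (adj G z q))
                                                           + b2n (is W q))))
            ≡ 2 + (nonNbrsI (is I) z + w)
      lhs = trans (sumFin-distrib-+ m _ _) (cong₂ _+_ size-U
            (trans (sumFin-distrib-+ m _ _) (cong₂ _+_ size-V (sumFin-distrib-+ m _ _))))
      rhs : sumFin m (λ q → b2n (complAdj G z q) + (b2n (is W q ∧ adj G z q) + b2n ⌊ z Fin.≟ q ⌋))
            ≡ deg (complement G) z + (degW z + 1)
      rhs = trans (sumFin-distrib-+ m _ _) (cong (deg (complement G) z +_)
            (trans (sumFin-distrib-+ m _ _) (cong (degW z +_) (count-≟ z))))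

    W-complDegSum : w * 2 + (sumOver (is W) (nonNbrsI (is I)) + w * w) ≤ complDegSum W + (sumW + w * 1)
    W-complDegSum = subst₂ _≤_ lhs rhs (sumOver-mono (is W) (λ z h → W-complDeg (facts W h)))
      where
      lhs : sumOver (is W) (λ z → 2 + (nonNbrsI (is I) z + w))
            ≡ w * 2 + (sumOver (is W) (nonNbrsI (is I)) + w * w)
      lhs = trans (sumOver-distrib-+ (is W) _ _) (cong₂ _+_ (sumOver-const (is W) 2)
            (trans (sumOver-distrib-+ (is W) _ _)
                   (cong (sumOver (is W) (nonNbrsI (is I)) +_) (sumOver-const (is W) w))))
      rhs : sumOver (is W) (λ z → deg (complement G) z + (degW z + 1)) ≡ complDegSum W + (sumW + w * 1)
      rhs = trans (sumOver-distrib-+ (is W) _ _) (cong (complDegSum W +_)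
            (trans (sumOver-distrib-+ (is W) _ _) (cong (sumW +_) (sumOver-const (is W) 1))))

    module _ (uv : adj G u v ≡ false) where

      A-complDeg : ∀ {x} → Facts A x → β + 1 ≤ deg (complement G) x
      A-complDeg {x} (ux , vx , v≢x) =
        subst (_≤ deg (complement G) x) (trans (sumFin-distrib-+ m _ _) (cong₂ _+_ dv (count-≟ v)))
              (sumFin-mono m pointwise)
        where
        pointwise : ∀ q → b2n (adj G v q) + b2n ⌊ v Fin.≟ q ⌋ ≤ b2n (complAdj G x q)
        pointwise q with v Fin.≟ q
        ... | yes refl rewrite irrefl G v | Graph.sym G x v | vx | ⌊≟⌋-false (v≢x ∘ sym) = ≤-refl
        ... | no v≢q with adj G v q in vq
        ...   | false = z≤n
        ...   | true rewrite A-B-nonadjacent ux v≢x vq (nonadj⇒≢ G (trans (Graph.sym G v u) uv) vq)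
                           | ⌊≟⌋-false (nonadj⇒≢ G vx vq) = ≤-refl

      B-complDeg : ∀ {y} → Facts B y → β + 1 ≤ deg (complement G) y
      B-complDeg {y} (uy , vy , u≢y) =
        subst (_≤ deg (complement G) y) (trans (sumFin-distrib-+ m _ _) (cong₂ _+_ du (count-≟ u)))
              (sumFin-mono m pointwise)
        where
        pointwise : ∀ q → b2n (adj G u q) + b2n ⌊ u Fin.≟ q ⌋ ≤ b2n (complAdj G y q)
        pointwise q with u Fin.≟ q
        ... | yes refl rewrite irrefl G u | Graph.sym G y u | uy | ⌊≟⌋-false (u≢y ∘ sym) = ≤-refl
        ... | no u≢q with adj G u q in uq
        ...   | false = z≤n
        ...   | true rewrite Graph.sym G y q | A-B-nonadjacent uq (nonadj⇒≢ G uv uq) vy u≢y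
                           | ⌊≟⌋-false (nonadj⇒≢ G uy uq) = ≤-refl

      complement-degree-sum : w ≤ size I →
        m + m + size A * (β + 1) + size B * (β + 1) + size I * m + (w * 2 + w * w)
          ≤ 2 * eCompl G + (2 * (β + 1) + size I * 3 + w + size I * w)
      complement-degree-sum w≤k =
        add-complDeg-bounds
          {2 * eCompl G} {complDegSum U} {complDegSum V} {complDegSum A} {complDegSum B}
          {complDegSum I} {complDegSum W} {sumI (is I)} {sumW} {sumOver (is W) (nonNbrsI (is I))}
          {size A} {size B} {size I} {w} {β} {m}
          (trans (sym (sumFin-by-kind (deg (complement G)))) (handshake (complement G)))
          (point-complDegSum U u id size-U du) (point-complDegSum V v id size-V dv)
          (side-complDegSum A A-complDeg) (side-complDegSum B B-complDeg)
          I-complDegSum W-complDegSum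
          (nonNbrsI+sumI≡kw (is I)) (sumW+2sumI≤2kw (is I) w≤k I-ties-no-W-path)

    module _ {n} (m≡ : m ≡ 2 * n + 1) (1≤c : 1 ≤ β ∸ n ∸ ε) where

      private
        c : ℕ
        c = β ∸ n ∸ ε
        b≡a : size B ≡ size A
        b≡a = proj₁ (class-sizes {n} m≡ du dv 1≤c)
        k≡ : size I ≡ w + (2 * c + 1)
        k≡ = proj₁ (proj₂ (class-sizes {n} m≡ du dv 1≤c))
        n≡ : n ≡ size A + w + c + 1
        n≡ = proj₂ (proj₂ (class-sizes {n} m≡ du dv 1≤c))

      w+2≤size[I] : w + 2 ≤ size I
      w+2≤size[I] = subst (w + 2 ≤_) (sym k≡)
                          (+-monoʳ-≤ w (≤-trans (*-monoʳ-≤ 2 1≤c) (m≤m+n (2 * c) 1)))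

      complement-bound : adj G u v ≡ false → n * n + c * c ∸ c ≤ eCompl G
      complement-bound uv = m≤n+o⇒m∸n≤o _ c (*-cancelˡ-≤ 2 (begin
        2 * (n * n + c * c)   ≤⟨ substitute-parameters {2 * eCompl G} {size A} {size I} {w} {c} {n} {β} {m}
                                                        k≡ β≡a+k n≡ m≡ counted ⟩
        2 * eCompl G + 2 * c  ≡⟨ +-comm (2 * eCompl G) (2 * c) ⟩
        2 * c + 2 * eCompl G  ≡⟨ *-distribˡ-+ 2 c (eCompl G) ⟨
        2 * (c + eCompl G)    ∎))
        where
        open ≤-Reasoning
        β≡a+k : β ≡ size A + size I
        β≡a+k = trans (sym du)
                (trans deg-u (trans (cong (λ b → size A + size I + b2n b) uv) (+-identityʳ _)))
        counted : m + m + size A * (β + 1) + size A * (β + 1) + size I * m + (w * 2 + w * w)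
                  ≤ 2 * eCompl G + (2 * (β + 1) + size I * 3 + w + size I * w)
        counted = subst (λ b → m + m + size A * (β + 1) + b * (β + 1) + size I * m + (w * 2 + w * w)
                               ≤ 2 * eCompl G + (2 * (β + 1) + size I * 3 + w + size I * w))
                        b≡a (complement-degree-sum uv (≤-trans (m≤m+n w 2) w+2≤size[I]))

lemma2p1 : (n : ℕ) → 2 ≤ n → (G : Graph (2 * n + 1)) →
    n * n + n ≤ e G → NoEqDegP3 G →
    (β : ℕ) → IsMaxRepeatedDeg G β →
    (u v : Fin (2 * n + 1)) → u ≢ v → deg G u ≡ β → deg G v ≡ β →
    let c = β ∸ n ∸ b2n (adj G u v) in
    1 ≤ c → n * n + c * c ∸ c ∸ b2n (adj G u v) ≤ eCompl G
lemma2p1 n _ G _ noP3 β _ u v u≢v du dv 1≤c = by-adjacency (adj G u v) refl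
  where
  open Neighbourhoods G u v u≢v
  c : ℕ
  c = β ∸ n ∸ ε
  by-adjacency : ∀ b → adj G u v ≡ b → n * n + c * c ∸ c ∸ ε ≤ eCompl G
  by-adjacency true  uv = ⊥-elim (no-edge-uv noP3 du dv uv (w+2≤size[I] noP3 du dv {n} refl 1≤c))
  by-adjacency false uv = ≤-trans (m∸n≤m _ ε) (complement-bound noP3 du dv {n} refl 1≤c uv)
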